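{- Let $G=(V,E)$ be a $CAD$-complete graph with Gallai--Edmonds decomposition $(C,A,D)$, and assume $C\ne\varnothing$ and $D\ne\varnothing$. Let $u\in C$ and $v\in D$, let $G'$ be obtained from $G$ by adding the edge $\{u,v\}$, and write $\mathsf{GE}(G')=(C',A',D')$. Then $G\subseteq G'$, $C'=\varnothing$, $A'=A\cup\{u\}$, and $\nu(G')=\nu(G)$.
   Context: $\nu$ denotes the matching number. A vertex of $G$ is essential if it is covered by every maximum matching of $G$, and inessential otherwise. The Gallai--Edmonds decomposition $\mathsf{GE}(G)=(C,A,D)$ is defined by: $D$ is the set of inessential vertices, $A$ is the set of vertices in $V\setminus D$ adjacent to at least one vertex of $D$, and $C=V\setminus(D\cup A)$. A graph $G$ with $\mathsf{GE}(G)=(C,A,D)$ is $CAD$-complete if it already contains every pair $\{u,v\}$ with $u,v\in C$, every pair with at least one endpoint in $A$, and every pair of vertices lying in a common connected component of $G[D]$. -}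

module Defs where

open import Data.Nat using (ℕ; _≤_)
open import Data.Fin using (Fin; _≟_)
open import Data.Bool using (Bool; true; false; _∧_; _∨_)
open import Data.Bool.Properties using (∨-comm; ∧-comm)
open import Data.List using (List; []; _∷_; length; concatMap)
open import Data.List.Relation.Unary.All using (All)
open import Data.List.Relation.Unary.Unique.Propositional using (Unique)
open import Data.List.Membership.Propositional using (_∈_)
open import Data.Product using (Σ; ∃; _×_; _,_; proj₁; proj₂)
open import Relation.Nullary using (¬_; yes; no)
open import Relation.Nullary.Decidable using (⌊_⌋)
open import Relation.Binary.PropositionalEquality using (_≡_; _≢_; refl; cong₂; trans; sym)
open import Data.Empty using (⊥-elim)

record Graph (n : ℕ) : Set where
  field
    adj     : Fin n → Fin n → Bool
    adj-sym : ∀ i j → adj i j ≡ adj j i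
    loopless : ∀ i → adj i i ≡ false
open Graph public

module _ {n : ℕ} (G : Graph n) where

  Edge : Fin n → Fin n → Set
  Edge i j = adj G i j ≡ true

  endpoints : List (Fin n × Fin n) → List (Fin n)
  endpoints = concatMap (λ e → proj₁ e ∷ proj₂ e ∷ [])

  IsMatching : List (Fin n × Fin n) → Set
  IsMatching M = All (λ e → Edge (proj₁ e) (proj₂ e)) M × Unique (endpoints M)

  IsMaximumMatching : List (Fin n × Fin n) → Set
  IsMaximumMatching M = IsMatching M × (∀ M' → IsMatching M' → length M' ≤ length M)

  MatchingNumber : ℕ → Set
  MatchingNumber k = Σ (List (Fin n × Fin n)) λ M → IsMaximumMatching M × length M ≡ k

  Essential : Fin n → Set
  Essential w = ∀ M → IsMaximumMatching M → w ∈ endpoints M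

  D : Fin n → Set
  D w = ¬ Essential w

  A : Fin n → Set
  A w = ¬ D w × ∃ λ x → D x × Edge w x

  C : Fin n → Set
  C w = ¬ D w × ¬ A w

  data ConnD : Fin n → Fin n → Set where
    here : ∀ {x} → D x → ConnD x x
    step : ∀ {x y z} → D x → Edge x y → ConnD y z → ConnD x z

  CADComplete : Set
  CADComplete =
      (∀ x y → x ≢ y → C x → C y → Edge x y)
    × (∀ x y → x ≢ y → A x → Edge x y)
    × (∀ x y → x ≢ y → ConnD x y → Edge x y)

  _⊆G_ : Graph n → Set
  _⊆G_ H = ∀ i j → Edge i j → adj H i j ≡ true

_==_ : ∀ {n} → Fin n → Fin n → Bool
i == j = ⌊ i ≟ j ⌋

private
  ==-sym : ∀ {n} (i j : Fin n) → (i == j) ≡ (j == i)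
  ==-sym i j with i ≟ j | j ≟ i
  ... | yes _ | yes _ = refl
  ... | no _ | no _ = refl
  ... | yes p | no q = ⊥-elim (q (sym p))
  ... | no p | yes q = ⊥-elim (p (sym q))

  pairAdj : ∀ {n} → Fin n → Fin n → Fin n → Fin n → Bool
  pairAdj u v i j = ((i == u) ∧ (j == v)) ∨ ((i == v) ∧ (j == u))

  pairAdj-sym : ∀ {n} (u v i j : Fin n) → pairAdj u v i j ≡ pairAdj u v j i
  pairAdj-sym u v i j =
    trans (∨-comm ((i == u) ∧ (j == v)) ((i == v) ∧ (j == u)))
          (cong₂ _∨_ (∧-comm (i == v) (j == u)) (∧-comm (i == u) (j == v)))

  pairAdj-irr : ∀ {n} (u v : Fin n) → u ≢ v → ∀ i → pairAdj u v i i ≡ false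
  pairAdj-irr u v u≢v i with i ≟ u | i ≟ v
  ... | yes refl | yes refl = ⊥-elim (u≢v refl)
  ... | yes _ | no _ = refl
  ... | no _ | yes _ = refl
  ... | no _ | no _ = refl

addEdge : ∀ {n} → Graph n → (u v : Fin n) → u ≢ v → Graph n
addEdge G u v u≢v = record
  { adj = λ i j → adj G i j ∨ pairAdj u v i j
  ; adj-sym = λ i j → cong₂ _∨_ (adj-sym G i j) (pairAdj-sym u v i j)
  ; loopless = λ i → cong₂ _∨_ (loopless G i) (pairAdj-irr u v u≢v i)
  }

C≢D : ∀ {n} (G : Graph n) {u v : Fin n} → C G u → D G v → u ≢ v
C≢D G (¬Du , _) Dv refl = ¬Du Dv

-- Adding uv does not enlarge a maximum matching: a larger one would have to use uv, and
-- dropping uv would leave a maximum matching of G missing the essential vertex u.  Hence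
-- the maximum matchings of G stay maximum in G' and D ⊆ D'.  A vertex w ≠ u of C becomes
-- inessential: take a maximum matching M of G missing v; it covers u, say by uy, and w, say
-- by wz (unless w = y).  The vertices y and z lie outside D (they are neighbours of C), so
-- yz is an edge, and replacing uy, wz by uv, yz gives a maximum matching of G' missing w.
-- Conversely u and the vertices of A stay essential, and every vertex outside D' other than
-- u is adjacent to v ∈ D', so it lies in A'.
module Submission where

open import Defs
open import Data.Bool using (true; false; _∧_; _∨_)
import Data.Bool as Bool
open import Data.Bool.Properties using (∨-zeroʳ)
open import Data.Empty using (⊥; ⊥-elim)
open import Data.Fin using (Fin; zero; suc; _≟_)
open import Data.Fin.Properties using (any?; injective⇒≤)
open import Data.List using (List; []; _∷_; length; lookup)
open import Data.List.Membership.Propositional using (_∈_; _∉_)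
open import Data.List.Membership.Propositional.Properties using (∈-lookup)
open import Data.List.Relation.Binary.Permutation.Propositional
  using (_↭_; ↭-refl; ↭-sym; ↭-trans; ↭-prep; ↭-swap; ↭⇒↭ₛ)
open import Data.List.Relation.Binary.Permutation.Propositional.Properties using (∈-resp-↭; shifts)
import Data.List.Relation.Binary.Permutation.Setoid.Properties as PermutationSetoid
open import Data.List.Relation.Unary.All as All using (All; []; _∷_)
open import Data.List.Relation.Unary.All.Properties using (¬Any⇒All¬; All¬⇒¬Any)
open import Data.List.Relation.Unary.AllPairs using ([]; _∷_)
open import Data.List.Relation.Unary.Any using (here; there)
open import Data.List.Relation.Unary.Unique.Propositional using (Unique)
import Data.List.Relation.Unary.Unique.DecPropositional as DecUnique
open import Data.Nat using (ℕ; zero; suc; _≤_; z≤n; s≤s; _≤?_; s≤s⁻¹)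
open import Data.Nat.Properties using (≤-trans; ≤-reflexive; m≤n⇒m≤1+n; ≰⇒>; ≤∧≢⇒<)
open import Data.Product using (Σ; ∃; ∃₂; _×_; _,_; proj₁; proj₂)
open import Data.Sum using (_⊎_; inj₁; inj₂)
open import Data.Vec using (Vec; []; _∷_; toList; fromList)
open import Data.Vec.Properties using (length-toList; toList∘fromList)
open import Function using (_∘_)
open import Function.Bundles using (_⇔_; mk⇔)
open import Relation.Binary.PropositionalEquality
  using (_≡_; _≢_; refl; sym; trans; cong; subst; setoid)
open import Relation.Nullary using (¬_; Dec; yes; no; ⌊_⌋)
open import Relation.Nullary.Decidable using (map′; _×-dec_; decidable-stable; ¬¬-excluded-middle)
open import Relation.Unary using (Decidable)

Unique-resp-↭ : ∀ {X : Set} {xs ys : List X} → xs ↭ ys → Unique xs → Unique ys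
Unique-resp-↭ {X} p = PermutationSetoid.Unique-resp-↭ (setoid X) (↭⇒↭ₛ p)

Unique-exchange : ∀ {X : Set} {v w : X} {xs ys zs : List X} →
  Unique ys → v ∉ ys → ys ↭ w ∷ xs → zs ↭ v ∷ xs → Unique zs × w ∉ zs
Unique-exchange {v = v} {w} {xs} Uys v∉ys ys↭ zs↭ with Unique-resp-↭ ys↭ Uys
... | w≢xs ∷ Uxs = Unique-resp-↭ (↭-sym zs↭) (v≢xs ∷ Uxs) , w∉v∷xs ∘ ∈-resp-↭ zs↭
  where
  v≢w∷xs : All (v ≢_) (w ∷ xs)
  v≢w∷xs = ¬Any⇒All¬ _ (v∉ys ∘ ∈-resp-↭ (↭-sym ys↭))
  v≢xs = All.tail v≢w∷xs
  w∉v∷xs : w ∉ v ∷ xs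
  w∉v∷xs (here w≡v) = All.head v≢w∷xs (sym w≡v)
  w∉v∷xs (there w∈xs) = All¬⇒¬Any w≢xs w∈xs

Unique⇒lookup-injective : ∀ {X : Set} {xs : List X} → Unique xs →
  ∀ {i j} → lookup xs i ≡ lookup xs j → i ≡ j
Unique⇒lookup-injective (_ ∷ _) {zero} {zero} _ = refl
Unique⇒lookup-injective (x≢xs ∷ _) {zero} {suc j} eq = ⊥-elim (All.lookup x≢xs (∈-lookup j) eq)
Unique⇒lookup-injective (x≢xs ∷ _) {suc i} {zero} eq = ⊥-elim (All.lookup x≢xs (∈-lookup i) (sym eq))
Unique⇒lookup-injective (_ ∷ U) {suc i} {suc j} eq = cong suc (Unique⇒lookup-injective U eq)

Unique-length≤ : ∀ {n} {xs : List (Fin n)} → Unique xs → length xs ≤ n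
Unique-length≤ U = injective⇒≤ (Unique⇒lookup-injective U)

Searchable : Set → Set₁
Searchable X = ∀ {P : X → Set} → Decidable P → Dec (∃ P)

search-× : ∀ {X Y} → Searchable X → Searchable Y → Searchable (X × Y)
search-× searchX searchY P? =
  map′ (λ (x , y , p) → (x , y) , p) (λ ((x , y) , p) → x , y , p)
       (searchX λ x → searchY λ y → P? (x , y))

search-Vec : ∀ {X} → Searchable X → ∀ k → Searchable (Vec X k)
search-Vec searchX zero P? = map′ ([] ,_) (λ { ([] , p) → p }) (P? [])
search-Vec searchX (suc k) P? =
  map′ (λ (x , xs , p) → x ∷ xs , p) (λ { (x ∷ xs , p) → x , xs , p })
       (searchX λ x → search-Vec searchX k (λ xs → P? (x ∷ xs)))

largest-witness : ∀ {P : ℕ → Set} → Decidable P → ∀ N → (∀ k → P k → k ≤ N) →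
  ∀ {m} → P m → ∃ λ k → P k × (∀ j → P j → j ≤ k)
largest-witness P? zero bound pm = _ , pm , λ j pj → ≤-trans (bound j pj) z≤n
largest-witness P? (suc N) bound pm with P? (suc N)
... | yes pN = suc N , pN , bound
... | no ¬pN = largest-witness P? N (λ k pk → s≤s⁻¹ (≤∧≢⇒< (bound k pk) λ { refl → ¬pN pk })) pm

module _ {n : ℕ} (H : Graph n) where

  Edges : List (Fin n × Fin n) → Set
  Edges = All (λ e → Edge H (proj₁ e) (proj₂ e))

  _≃_ : List (Fin n × Fin n) → List (Fin n × Fin n) → Set
  M ≃ N = length M ≡ length N × endpoints H M ↭ endpoints H N

  Edge-sym : ∀ {a b} → Edge H a b → Edge H b a
  Edge-sym {a} {b} e = trans (adj-sym H b a) e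

  pull-to-front : ∀ {M x} → Edges M → x ∈ endpoints H M →
    ∃₂ λ y R → Edges ((x , y) ∷ R) × M ≃ ((x , y) ∷ R)
  pull-to-front {(a , b) ∷ M} (e ∷ es) (here refl) = b , M , e ∷ es , refl , ↭-refl
  pull-to-front {(a , b) ∷ M} (e ∷ es) (there (here refl)) = a , M , Edge-sym e ∷ es , refl , ↭-swap a b ↭-refl
  pull-to-front {(a , b) ∷ M} {x} (e ∷ es) (there (there x∈M)) with pull-to-front es x∈M
  ... | y , R , exy ∷ esR , size , cover =
    y , (a , b) ∷ R , exy ∷ e ∷ esR , cong suc size ,
    ↭-trans (↭-prep a (↭-prep b cover)) (shifts (a ∷ b ∷ []) (x ∷ y ∷ []))

  length≤length-endpoints : ∀ M → length M ≤ length (endpoints H M)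
  length≤length-endpoints [] = z≤n
  length≤length-endpoints (_ ∷ M) = s≤s (m≤n⇒m≤1+n (length≤length-endpoints M))

  matching-length≤ : ∀ {M} → IsMatching H M → length M ≤ n
  matching-length≤ {M} (_ , U) = ≤-trans (length≤length-endpoints M) (Unique-length≤ U)

  matching? : Decidable (IsMatching H)
  matching? M = All.all? (λ e → adj H (proj₁ e) (proj₂ e) Bool.≟ true) M
           ×-dec DecUnique.unique? _≟_ (endpoints H M)

  matching-of-length? : ∀ k → Dec (∃ λ M → IsMatching H M × length M ≡ k)
  matching-of-length? k =
    map′ (λ (xs , m) → toList xs , m , length-toList xs)
         (λ { (M , m , refl) → fromList M , subst (IsMatching H) (sym (toList∘fromList M)) m })
         (search-Vec (search-× any? any?) k (matching? ∘ toList))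

  maximum-matching : ∃ (IsMaximumMatching H)
  maximum-matching with largest-witness matching-of-length? n
                          (λ { _ (_ , m , refl) → matching-length≤ m }) ([] , ([] , []) , refl)
  ... | _ , (M , m , refl) , largest = M , m , λ M' m' → largest (length M') (M' , m' , refl)

  maximum-by-length : ∀ {M N} → IsMaximumMatching H M → IsMatching H N →
    length M ≤ length N → IsMaximumMatching H N
  maximum-by-length (_ , largest) n M≤N = n , λ M' m' → ≤-trans (largest M' m') M≤N

  open import Data.List.Membership.DecPropositional (_≟_ {n}) using (_∈?_)

  covered-if-¬D : ∀ {x M} → ¬ D H x → IsMaximumMatching H M → x ∈ endpoints H M
  covered-if-¬D {x} {M} ¬Dx M-max =
    decidable-stable (x ∈? endpoints H M) λ x∉M → ¬Dx λ x-ess → x∉M (x-ess M M-max)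

  uncovered-if-D : ∀ {x} → D H x → ¬ ¬ ∃ λ M → IsMaximumMatching H M × x ∉ endpoints H M
  uncovered-if-D {x} Dx ¬uncovered = Dx λ M M-max →
    decidable-stable (x ∈? endpoints H M) λ x∉M → ¬uncovered (M , M-max , x∉M)

module _ {n : ℕ} (G : Graph n) where

  C-neighbour-¬D : ∀ {x y} → C G x → Edge G x y → ¬ D G y
  C-neighbour-¬D (¬Dx , ¬Ax) e Dy = ¬Ax (¬Dx , _ , Dy , e)

  module _ (cad : CADComplete G) where

    A-adjacent : ∀ {x y} → A G x → x ≢ y → Edge G x y
    A-adjacent Ax x≢y = proj₁ (proj₂ cad) _ _ x≢y Ax

    ¬D-adjacent : ∀ {x y} → ¬ D G x → ¬ D G y → x ≢ y → Edge G x y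
    ¬D-adjacent {x} {y} ¬Dx ¬Dy x≢y =
      decidable-stable (adj G x y Bool.≟ true) λ ¬e →
      ¬¬-excluded-middle λ where
        (yes Ax) → ¬e (A-adjacent Ax x≢y)
        (no ¬Ax) → ¬¬-excluded-middle λ where
          (yes Ay) → ¬e (Edge-sym G (A-adjacent Ay (x≢y ∘ sym)))
          (no ¬Ay) → ¬e (proj₁ cad x y x≢y (¬Dx , ¬Ax) (¬Dy , ¬Ay))

module AddEdge {n : ℕ} (G : Graph n) {u v : Fin n} (u≢v : u ≢ v) where

  G' : Graph n
  G' = addEdge G u v u≢v

  ⊆-addEdge : G ⊆G G'
  ⊆-addEdge _ _ e = cong (_∨ _) e

  addEdge-edge : Edge G' u v
  addEdge-edge = fill (adj G u v) _ (u ≟ u) (v ≟ v)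
    where
    fill : ∀ g r (u≟u : Dec (u ≡ u)) (v≟v : Dec (v ≡ v)) → g ∨ ((⌊ u≟u ⌋ ∧ ⌊ v≟v ⌋) ∨ r) ≡ true
    fill g _ (yes _) (yes _) = ∨-zeroʳ g
    fill _ _ (no u≢u) _ = ⊥-elim (u≢u refl)
    fill _ _ (yes _) (no v≢v) = ⊥-elim (v≢v refl)

  addEdge-edge⁻ : ∀ {a b} → Edge G' a b → Edge G a b ⊎ (a ≡ u × b ≡ v) ⊎ (a ≡ v × b ≡ u)
  addEdge-edge⁻ {a} {b} = classify (adj G a b) (a ≟ u) (b ≟ v) (a ≟ v) (b ≟ u)
    where
    classify : ∀ g (a≟u : Dec (a ≡ u)) (b≟v : Dec (b ≡ v)) (a≟v : Dec (a ≡ v)) (b≟u : Dec (b ≡ u)) →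
      g ∨ ((⌊ a≟u ⌋ ∧ ⌊ b≟v ⌋) ∨ (⌊ a≟v ⌋ ∧ ⌊ b≟u ⌋)) ≡ true →
      g ≡ true ⊎ (a ≡ u × b ≡ v) ⊎ (a ≡ v × b ≡ u)
    classify true _ _ _ _ _ = inj₁ refl
    classify false (yes a≡u) (yes b≡v) _ _ _ = inj₂ (inj₁ (a≡u , b≡v))
    classify false _ _ (yes a≡v) (yes b≡u) _ = inj₂ (inj₂ (a≡v , b≡u))
    classify false (no _) _ (no _) _ ()
    classify false (no _) _ (yes _) (no _) ()
    classify false (yes _) (no _) (no _) _ ()
    classify false (yes _) (no _) (yes _) (no _) ()

  lower-edge : ∀ {a b} → Edge G' a b → a ≢ u → b ≢ u → Edge G a b
  lower-edge e a≢u b≢u with addEdge-edge⁻ e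
  ... | inj₁ e-old = e-old
  ... | inj₂ (inj₁ (a≡u , _)) = ⊥-elim (a≢u a≡u)
  ... | inj₂ (inj₂ (_ , b≡u)) = ⊥-elim (b≢u b≡u)

  lower-edge-at-u : ∀ {y} → Edge G' u y → y ≢ v → Edge G u y
  lower-edge-at-u e y≢v with addEdge-edge⁻ e
  ... | inj₁ e-old = e-old
  ... | inj₂ (inj₁ (_ , y≡v)) = ⊥-elim (y≢v y≡v)
  ... | inj₂ (inj₂ (u≡v , _)) = ⊥-elim (u≢v u≡v)

  lower-edges : ∀ {M} → Edges G' M → u ∉ endpoints G M → Edges G M
  lower-edges [] _ = []
  lower-edges (e ∷ es) u∉ =
    lower-edge e (u∉ ∘ here ∘ sym) (u∉ ∘ there ∘ here ∘ sym) ∷ lower-edges es (u∉ ∘ there ∘ there)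

  lift-edges : ∀ {M} → Edges G M → Edges G' M
  lift-edges = All.map (⊆-addEdge _ _)

  lift-matching : ∀ {M} → IsMatching G M → IsMatching G' M
  lift-matching (es , U) = lift-edges es , U

  data Split (M' : List (Fin n × Fin n)) : Set where
    old : ∀ {N} → IsMatching G N → _≃_ G M' N → Split M'
    new : ∀ {N} → IsMatching G N → u ∉ endpoints G N → _≃_ G M' ((u , v) ∷ N) → Split M'

  open import Data.List.Membership.DecPropositional (_≟_ {n}) using (_∈?_)

  split : ∀ {M'} → IsMatching G' M' → Split M'
  split {M'} (es , U) with u ∈? endpoints G M'
  ... | no u∉M' = old (lower-edges es u∉M' , U) (refl , ↭-refl)
  ... | yes u∈M' with pull-to-front G' es u∈M'
  ... | y , R , euy ∷ esR , M'≃ with Unique-resp-↭ (proj₂ M'≃) U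
  ... | U'@((_ ∷ u≢R) ∷ (_ ∷ UR)) = by-partner (y ≟ v)
    -- not `with y ≟ v`: that would also abstract `y ≟ v` inside the type of euy
    where
    u∉R = All¬⇒¬Any u≢R
    by-partner : Dec (y ≡ v) → Split M'
    by-partner (yes refl) = new (lower-edges esR u∉R , UR) u∉R M'≃
    by-partner (no y≢v) = old (lower-edge-at-u euy y≢v ∷ lower-edges esR u∉R , U') M'≃

  lower-maximum : ∀ {M' N} → IsMaximumMatching G' M' → IsMatching G N → length M' ≡ length N →
    IsMaximumMatching G N
  lower-maximum (_ , largest') n M'≡N =
    n , λ N' n' → subst (length N' ≤_) M'≡N (largest' N' (lift-matching n'))

  module _ (¬Du : ¬ D G u) where

    maximum-lift : ∀ {M} → IsMaximumMatching G M → IsMaximumMatching G' M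
    maximum-lift {M} M-max@(m , largest) = lift-matching m , λ M' m' → bound (split m')
      where
      bound : ∀ {M'} → Split M' → length M' ≤ length M
      bound (old n (M'≡N , _)) = ≤-trans (≤-reflexive M'≡N) (largest _ n)
      bound {M'} (new {N} n u∉N (M'≡1+N , _)) with length M' ≤? length M
      ... | yes M'≤M = M'≤M
      ... | no M'≰M = ⊥-elim (¬Du λ u-ess → u∉N (u-ess N N-max))
        where
        N-max = maximum-by-length G M-max n (s≤s⁻¹ (subst (suc (length M) ≤_) M'≡1+N (≰⇒> M'≰M)))

    D-lift : ∀ {w} → D G w → D G' w
    D-lift Dw w-ess' = Dw λ M M-max → w-ess' M (maximum-lift M-max)

    ¬D'-u : ¬ D G' u
    ¬D'-u D'u = D'u λ M' M'-max → covered M'-max (split (proj₁ M'-max))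
      where
      covered : ∀ {M'} → IsMaximumMatching G' M' → Split M' → u ∈ endpoints G M'
      covered M'-max (old n (M'≡N , M'↭N)) =
        ∈-resp-↭ (↭-sym M'↭N) (covered-if-¬D G ¬Du (lower-maximum M'-max n M'≡N))
      covered _ (new _ _ (_ , M'↭uv∷N)) = ∈-resp-↭ (↭-sym M'↭uv∷N) (here refl)

  module _ (cad : CADComplete G) (Cu : C G u) (Dv : D G v) where

    private
      ¬Du = proj₁ Cu

    C⇒D' : ∀ {w} → C G w → w ≢ u → D G' w
    C⇒D' {w} Cw w≢u w-ess' = uncovered-if-D G Dv λ (M , M-max , v∉M) → refute M-max v∉M
      where
      refute : ∀ {M} → IsMaximumMatching G M → v ∉ endpoints G M → ⊥
      refute {M} M-max@((es , U) , _) v∉M with pull-to-front G es (covered-if-¬D G ¬Du M-max)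
      ... | y , R₁ , euy ∷ esR₁ , M≡1+R₁ , M↭uy∷R₁ = by-partner (w ≟ y)
        where
        exchange : ∀ P xs → Edges G' P → length M ≡ length P →
          endpoints G M ↭ w ∷ xs → endpoints G P ↭ v ∷ xs → ⊥
        exchange P xs esP M≡P M↭ P↭ with Unique-exchange U v∉M M↭ P↭
        ... | UP , w∉P =
          w∉P (w-ess' P (maximum-by-length G' (maximum-lift ¬Du M-max) (esP , UP) (≤-reflexive M≡P)))

        by-partner : Dec (w ≡ y) → ⊥
        by-partner (yes refl) =
          exchange ((u , v) ∷ R₁) (u ∷ endpoints G R₁) (addEdge-edge ∷ lift-edges esR₁) M≡1+R₁
                   (↭-trans M↭uy∷R₁ (↭-swap u w ↭-refl)) (↭-swap u v ↭-refl)
        by-partner (no w≢y) with ∈-resp-↭ M↭uy∷R₁ (w-ess' M (maximum-lift ¬Du M-max))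
        ... | here w≡u = w≢u w≡u
        ... | there (here w≡y) = w≢y w≡y
        ... | there (there w∈R₁) with pull-to-front G esR₁ w∈R₁
        ... | z , R₂ , ewz ∷ esR₂ , R₁≡1+R₂ , R₁↭wz∷R₂ =
          exchange ((u , v) ∷ (y , z) ∷ R₂) (u ∷ y ∷ z ∷ endpoints G R₂)
                   (addEdge-edge ∷ ⊆-addEdge _ _ eyz ∷ lift-edges esR₂) (trans M≡1+R₁ (cong suc R₁≡1+R₂))
                   (↭-trans M↭uy∷R₁ (↭-trans (↭-prep u (↭-prep y R₁↭wz∷R₂)) (shifts (u ∷ y ∷ []) (w ∷ []))))
                   (↭-swap u v ↭-refl)
          where
          y≢z : y ≢ z
          y≢z with Unique-resp-↭ M↭uy∷R₁ U
          ... | _ ∷ y≢R₁ ∷ _ = All.lookup y≢R₁ (∈-resp-↭ (↭-sym R₁↭wz∷R₂) (there (here refl)))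
          eyz : Edge G y z
          eyz = ¬D-adjacent G cad (C-neighbour-¬D G Cu euy) (C-neighbour-¬D G Cw ewz) y≢z

    A⇒¬D' : ∀ {w} → A G w → ¬ D G' w
    A⇒¬D' {w} Aw@(¬Dw , _) D'w = D'w λ M' M'-max →
      decidable-stable (w ∈? endpoints G M') λ w∉M' → refute M'-max w∉M' (split (proj₁ M'-max))
      where
      refute : ∀ {M'} → IsMaximumMatching G' M' → w ∉ endpoints G M' → Split M' → ⊥
      refute M'-max w∉M' (old n (M'≡N , M'↭N)) =
        w∉M' (∈-resp-↭ (↭-sym M'↭N) (covered-if-¬D G ¬Dw (lower-maximum M'-max n M'≡N)))
      refute {M'} M'-max w∉M' (new {N} (esN , _) _ (M'≡1+N , M'↭uv∷N))
        with Unique-exchange (proj₂ (proj₁ M'-max)) w∉M' M'↭uv∷N ↭-refl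
      ... | UQ , u∉Q = u∉Q (covered-if-¬D G ¬Du (lower-maximum M'-max Q-matching M'≡1+N))
        where
        Q-matching : IsMatching G ((w , v) ∷ N)
        Q-matching = A-adjacent G cad Aw (λ { refl → ¬Dw Dv }) ∷ esN , UQ

    ¬D'⇒edge-v : ∀ {w} → w ≢ u → ¬ D G' w → Edge G w v
    ¬D'⇒edge-v {w} w≢u ¬D'w = decidable-stable (adj G w v Bool.≟ true) λ ¬e →
      ¬¬-excluded-middle λ where
        (yes Aw) → ¬e (A-adjacent G cad Aw λ { refl → ¬Dw Dv })
        (no ¬Aw) → ¬D'w (C⇒D' (¬Dw , ¬Aw) w≢u)
      where
      ¬Dw = ¬D'w ∘ D-lift ¬Du

    ¬D'⇒A' : ∀ {w} → ¬ D G' w → A G' w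
    ¬D'⇒A' {w} ¬D'w = ¬D'w , v , D-lift ¬Du Dv , edge-to-v (w ≟ u)
      where
      edge-to-v : Dec (w ≡ u) → Edge G' w v
      edge-to-v (yes refl) = addEdge-edge
      edge-to-v (no w≢u) = ⊆-addEdge _ _ (¬D'⇒edge-v w≢u ¬D'w)

    A'⇔A⊎u : ∀ {w} → A G' w ⇔ (A G w ⊎ w ≡ u)
    A'⇔A⊎u = mk⇔ to from
      where
      to : ∀ {w} → A G' w → A G w ⊎ w ≡ u
      to {w} (¬D'w , _) with w ≟ u
      ... | yes w≡u = inj₂ w≡u
      ... | no w≢u = inj₁ (¬D'w ∘ D-lift ¬Du , v , Dv , ¬D'⇒edge-v w≢u ¬D'w)
      from : ∀ {w} → A G w ⊎ w ≡ u → A G' w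
      from (inj₁ Aw@(_ , x , Dx , e)) = A⇒¬D' Aw , x , D-lift ¬Du Dx , ⊆-addEdge _ _ e
      from (inj₂ refl) = ¬D'-u ¬Du , v , D-lift ¬Du Dv , addEdge-edge

lemma2p8 : ∀ {n} (G : Graph n) → CADComplete G
    → ∃ (C G) → ∃ (D G)
    → (u v : Fin n) → (Cu : C G u) → (Dv : D G v)
    → let G' = addEdge G u v (C≢D G Cu Dv) in
      (G ⊆G G')
    × (∀ w → ¬ C G' w)
    × (∀ w → A G' w ⇔ (A G w ⊎ w ≡ u))
    × Σ ℕ (λ k → MatchingNumber G k × MatchingNumber G' k)
lemma2p8 G cad _ _ u v Cu Dv with maximum-matching G
... | M , M-max =
    ⊆-addEdge
  , (λ w (¬D'w , ¬A'w) → ¬A'w (¬D'⇒A' cad Cu Dv ¬D'w))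
  , (λ w → A'⇔A⊎u cad Cu Dv)
  , length M , (M , M-max , refl) , (M , maximum-lift (proj₁ Cu) M-max , refl)
  where
  open AddEdge G (C≢D G Cu Dv)
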